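{- Let $H\le G\le\mathrm{Sym}(n)$ with both $H$ and $G$ transitive, and assume $H$ has the EKR property. If $D\subseteq\mathrm{Der}(G)$ is inverse-closed with $D\subseteq G\setminus H$, then $\alpha(\mathrm{Cay}(G,\mathrm{Der}(G)\setminus D))=|G|/n$.
   Context: A derangement is a permutation with no fixed point; $\mathrm{Der}(K)$ is the set of derangements of a permutation group $K$. For inverse-closed $S\subseteq K$ not containing the identity, $\mathrm{Cay}(K,S)$ is the graph on $K$ with $g,h$ adjacent iff $g^{ -1}h\in S$; $\Gamma_K=\mathrm{Cay}(K,\mathrm{Der}(K))$; $\alpha$ denotes independence number. A transitive $K\le\mathrm{Sym}(n)$ has the EKR property if $\alpha(\Gamma_K)=|K|/n$. -}

module Defs where

open import Data.Nat using (ℕ; _≤_; _/_; NonZero)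
open import Data.Fin using (Fin)
open import Data.Vec using (Vec; lookup; tabulate)
open import Data.List using (List; length)
open import Data.List.Membership.Propositional using (_∈_; _∉_)
open import Data.List.Relation.Unary.All using (All)
open import Data.List.Relation.Unary.Unique.Propositional using (Unique)
open import Data.Product using (Σ; ∃; _×_)
open import Relation.Binary.PropositionalEquality using (_≡_; _≢_)
open import Relation.Nullary using (¬_)
open import Function.Definitions using (Injective)

-- A map Fin n → Fin n, stored as the vector of its values (so equality is ≡).
Map : ℕ → Set
Map n = Vec (Fin n) n

app : ∀ {n} → Map n → Fin n → Fin n
app σ i = lookup σ i

-- σ is a permutation of Fin n (injective, hence bijective on a finite set).
IsPerm : ∀ {n} → Map n → Set
IsPerm σ = Injective _≡_ _≡_ (app σ)

idP : ∀ {n} → Map n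
idP = tabulate (λ i → i)

_∘ₚ_ : ∀ {n} → Map n → Map n → Map n
σ ∘ₚ τ = tabulate (λ i → app σ (app τ i))

IsInverse : ∀ {n} → Map n → Map n → Set
IsInverse g h = g ∘ₚ h ≡ idP

record IsPermGroup {n : ℕ} (K : List (Map n)) : Set where
  field
    unique  : Unique K
    perms   : All IsPerm K
    has-id  : idP ∈ K
    closed  : ∀ {g h} → g ∈ K → h ∈ K → (g ∘ₚ h) ∈ K
    inverse : ∀ {g} → g ∈ K → Σ (Map n) λ h → h ∈ K × IsInverse g h

_⊆G_ : ∀ {n} → List (Map n) → List (Map n) → Set
H ⊆G G = All (_∈ G) H

IsTransitive : ∀ {n} → List (Map n) → Set
IsTransitive {n} K = ∀ (i j : Fin n) → Σ (Map n) λ g → g ∈ K × app g i ≡ j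

IsDerangement : ∀ {n} → Map n → Set
IsDerangement {n} g = ∀ (i : Fin n) → app g i ≢ i

Der : ∀ {n} → List (Map n) → Map n → Set
Der K g = g ∈ K × IsDerangement g

-- Cay(K,S): g,h ∈ K adjacent iff g⁻¹h ∈ S, i.e. h = g s for some s ∈ S.
CayAdj : ∀ {n} → (Map n → Set) → Map n → Map n → Set
CayAdj {n} S g h = Σ (Map n) λ s → S s × h ≡ g ∘ₚ s

IsIndependent : ∀ {n} → List (Map n) → (Map n → Set) → List (Map n) → Set
IsIndependent K S I =
  Unique I × All (_∈ K) I × (∀ {g h} → g ∈ I → h ∈ I → ¬ CayAdj S g h)

IndependenceNumberIs : ∀ {n} → List (Map n) → (Map n → Set) → ℕ → Set
IndependenceNumberIs {n} K S m =
  (Σ (List (Map n)) λ I → IsIndependent K S I × length I ≡ m)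
  × (∀ (I : List (Map n)) → IsIndependent K S I → length I ≤ m)

HasEKR : (n : ℕ) .{{_ : NonZero n}} → List (Map n) → Set
HasEKR n K = IndependenceNumberIs K (Der K) (length K / n)

-- Lower bound: a point stabiliser of G is independent even in the full derangement graph Γ_G,
-- and transitivity gives |G| ≤ n·|G_i|.  Upper bound: for an independent set I of
-- Cay(G, Der(G) ∖ D), count the pairs (x, k) ∈ G × H with x k ∈ I.  For fixed k there are |I|
-- of them; for fixed x the k's form an independent set of Γ_H, because D avoids H, so there
-- are at most |H|/n.  Hence |H|·|I| ≤ |G|·|H|/n.
module Submission where

open import Defs
open import Data.Bool using (true; false; if_then_else_)
open import Data.Nat using (ℕ; zero; suc; _+_; _*_; _/_; _≤_; z≤n; s≤s; NonZero; >-nonZero)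
open import Data.Nat.Properties hiding (_≟_)
open import Algebra.Properties.CommutativeSemigroup +-commutativeSemigroup using () renaming (interchange to +-interchange)
open import Data.Nat.DivMod using (m*n/n≡m; m/n*n≤m; /-monoˡ-≤)
open import Data.Nat.ListAction using (sum)
open import Data.Fin using (Fin; _≟_)
import Data.Fin as Fin
open import Data.Vec.Properties using (lookup∘tabulate; tabulate∘lookup; tabulate-cong; ≡-dec)
open import Data.List using (List; []; _∷_; length; map; filter; take; allFin)
open import Data.List.Properties using (length-map; map-cong; length-removeAt′; length-take; length-tabulate)
open import Data.List.Membership.Propositional using (_∈_; _∉_)
open import Data.List.Membership.Propositional.Properties using (∈-map⁻; ∈-filter⁺; ∈-filter⁻; ∈-allFin; ∈-length)
import Data.List.Membership.DecPropositional as DecMembership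
open import Data.List.Relation.Unary.Any using (here; there; index; _─_)
import Data.List.Relation.Unary.All as All
open import Data.List.Relation.Unary.Unique.Propositional using (Unique; _∷_)
import Data.List.Relation.Unary.Unique.Propositional.Properties as Unique
open import Data.List.Relation.Binary.Subset.Propositional using (_⊆_)
open import Data.List.Relation.Binary.Sublist.Propositional using () renaming (lookup to sublist-lookup)
open import Data.List.Relation.Binary.Sublist.Propositional.Properties using (take-⊆)
open import Data.Product using (Σ; _×_; _,_; proj₁; proj₂)
open import Data.Empty using (⊥-elim-irr)
open import Relation.Nullary using (¬_; Dec; does; contradiction)
open import Relation.Unary using (Decidable)
open import Relation.Binary.Definitions using (DecidableEquality)
open import Relation.Binary.PropositionalEquality
open import Function using (_∘_)

module _ {A : Set} where

  ∑ : List A → (A → ℕ) → ℕ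
  ∑ xs f = sum (map f xs)

  syntax ∑ xs (λ x → e) = ∑[ x ∈ xs ] e

  ∑-+ : (xs : List A) (f g : A → ℕ) → ∑[ x ∈ xs ] (f x + g x) ≡ ∑ xs f + ∑ xs g
  ∑-+ []       f g = refl
  ∑-+ (x ∷ xs) f g = begin
    f x + g x + (∑[ x ∈ xs ] (f x + g x)) ≡⟨ cong (f x + g x +_) (∑-+ xs f g) ⟩
    f x + g x + (∑ xs f + ∑ xs g)         ≡⟨ +-interchange (f x) (g x) (∑ xs f) (∑ xs g) ⟩
    f x + ∑ xs f + (g x + ∑ xs g)         ∎
    where open ≡-Reasoning

  ∑-const : (xs : List A) (c : ℕ) → ∑[ x ∈ xs ] c ≡ length xs * c
  ∑-const []       c = refl
  ∑-const (x ∷ xs) c = cong (c +_) (∑-const xs c)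

  ∑-mono-≤ : (xs : List A) {f g : A → ℕ} → (∀ {x} → x ∈ xs → f x ≤ g x) → ∑ xs f ≤ ∑ xs g
  ∑-mono-≤ []       f≤g = z≤n
  ∑-mono-≤ (x ∷ xs) f≤g = +-mono-≤ (f≤g (here refl)) (∑-mono-≤ xs (f≤g ∘ there))

∑-comm : {A B : Set} (xs : List A) (ys : List B) (f : A → B → ℕ) →
         ∑[ y ∈ ys ] ∑[ x ∈ xs ] f x y ≡ ∑[ x ∈ xs ] ∑[ y ∈ ys ] f x y
∑-comm []       ys f = trans (∑-const ys 0) (*-zeroʳ (length ys))
∑-comm (x ∷ xs) ys f =
  trans (∑-+ ys (f x) (λ y → ∑[ x ∈ xs ] f x y)) (cong (∑ ys (f x) +_) (∑-comm xs ys f))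

module _ {A : Set} {P : A → Set} (P? : Decidable P) where

  indicator : A → ℕ
  indicator x = if does (P? x) then 1 else 0

  length-filter≡∑-indicator : (xs : List A) → length (filter P? xs) ≡ ∑ xs indicator
  length-filter≡∑-indicator []       = refl
  length-filter≡∑-indicator (x ∷ xs) with does (P? x)
  ... | true  = cong suc (length-filter≡∑-indicator xs)
  ... | false = length-filter≡∑-indicator xs

double-counting : {A B : Set} {R : A → B → Set} (R? : ∀ x y → Dec (R x y))
                  (xs : List A) (ys : List B) →
                  ∑[ y ∈ ys ] length (filter (λ x → R? x y) xs)
                    ≡ ∑[ x ∈ xs ] length (filter (R? x) ys)
double-counting R? xs ys = begin
  ∑[ y ∈ ys ] length (filter (λ x → R? x y) xs)
    ≡⟨ cong sum (map-cong (λ y → length-filter≡∑-indicator (λ x → R? x y) xs) ys) ⟩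
  ∑[ y ∈ ys ] ∑[ x ∈ xs ] indicator (λ x → R? x y) x
    ≡⟨ ∑-comm xs ys (λ x y → indicator (λ x → R? x y) x) ⟩
  ∑[ x ∈ xs ] ∑[ y ∈ ys ] indicator (R? x) y
    ≡⟨ cong sum (map-cong (λ x → sym (length-filter≡∑-indicator (R? x) ys)) xs) ⟩
  ∑[ x ∈ xs ] length (filter (R? x) ys) ∎
  where
  open ≡-Reasoning

module _ {A : Set} where

  ∈-─⁺ : {x y : A} {ys : List A} (x∈ys : x ∈ ys) → y ∈ ys → x ≢ y → y ∈ (ys ─ x∈ys)
  ∈-─⁺ (here refl) (here refl)  x≢y = contradiction refl x≢y
  ∈-─⁺ (here refl) (there y∈ys) x≢y = y∈ys
  ∈-─⁺ (there x∈ys) (here refl) x≢y = here refl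
  ∈-─⁺ (there x∈ys) (there y∈ys) x≢y = there (∈-─⁺ x∈ys y∈ys x≢y)

  unique-⊆⇒length-≤ : {xs ys : List A} → Unique xs → xs ⊆ ys → length xs ≤ length ys
  unique-⊆⇒length-≤ {[]}     _               _     = z≤n
  unique-⊆⇒length-≤ {x ∷ xs} {ys} (x∉xs ∷ u) xs⊆ys = begin
    suc (length xs)          ≤⟨ s≤s (unique-⊆⇒length-≤ u tail⊆) ⟩
    suc (length (ys ─ x∈ys)) ≡⟨ sym (length-removeAt′ ys (index x∈ys)) ⟩
    length ys                ∎
    where
    open ≤-Reasoning
    x∈ys = xs⊆ys (here refl)
    tail⊆ : xs ⊆ (ys ─ x∈ys)
    tail⊆ y∈xs = ∈-─⁺ x∈ys (xs⊆ys (there y∈xs)) (All.lookup x∉xs y∈xs)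

injection⇒length-≤ : {A B : Set} {xs : List A} {ys : List B} (f : A → B) →
                     (∀ {x y} → f x ≡ f y → x ≡ y) → Unique xs →
                     (∀ {x} → x ∈ xs → f x ∈ ys) → length xs ≤ length ys
injection⇒length-≤ {xs = xs} f f-inj u f∈ys = begin
  length xs         ≡⟨ sym (length-map f xs) ⟩
  length (map f xs) ≤⟨ unique-⊆⇒length-≤ (Unique.map⁺ f-inj u) map-⊆ ⟩
  _                 ∎
  where
  open ≤-Reasoning
  map-⊆ : map f xs ⊆ _
  map-⊆ fx∈ with ∈-map⁻ f fx∈
  ... | x , x∈xs , refl = f∈ys x∈xs

length≤∑-fibres : {A B : Set} (_≟B_ : DecidableEquality B) (f : A → B) (xs : List A) (ys : List B) →
                  (∀ x → f x ∈ ys) → length xs ≤ ∑[ y ∈ ys ] length (filter (λ x → f x ≟B y) xs)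
length≤∑-fibres _≟B_ f xs ys f∈ys = begin
  length xs                                        ≡⟨ sym (trans (∑-const xs 1) (*-identityʳ _)) ⟩
  ∑[ x ∈ xs ] 1                                    ≤⟨ ∑-mono-≤ xs (λ {x} _ → ∈-length (∈-filter⁺ (f x ≟B_) (f∈ys x) refl)) ⟩
  ∑[ x ∈ xs ] length (filter (f x ≟B_) ys)         ≡⟨ sym (double-counting (λ x y → f x ≟B y) xs ys) ⟩
  ∑[ y ∈ ys ] length (filter (λ x → f x ≟B y) xs) ∎
  where open ≤-Reasoning

m*n≤o*[m/p]⇒n≤o/p : ∀ m {n} o p .{{_ : NonZero m}} .{{_ : NonZero p}} →
                    m * n ≤ o * (m / p) → n ≤ o / p
m*n≤o*[m/p]⇒n≤o/p m {n} o p mn≤o[m/p] =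
  subst (_≤ o / p) (m*n/n≡m n p) (/-monoˡ-≤ p (*-cancelˡ-≤ m m[np]≤mo))
  where
  open ≤-Reasoning
  m[np]≤mo : m * (n * p) ≤ m * o
  m[np]≤mo = begin
    m * (n * p)       ≡⟨ sym (*-assoc m n p) ⟩
    m * n * p         ≤⟨ *-monoˡ-≤ p mn≤o[m/p] ⟩
    o * (m / p) * p   ≡⟨ *-assoc o (m / p) p ⟩
    o * (m / p * p)   ≤⟨ *-monoʳ-≤ o (m/n*n≤m m p) ⟩
    o * m             ≡⟨ *-comm o m ⟩
    m * o             ∎

m≤n*o⇒m/n≤o : ∀ {m} n {o} .{{_ : NonZero n}} → m ≤ n * o → m / n ≤ o
m≤n*o⇒m/n≤o {m} n {o} m≤no =
  subst (m / n ≤_) (trans (cong (_/ n) (*-comm n o)) (m*n/n≡m o n)) (/-monoˡ-≤ n m≤no)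

module _ {n : ℕ} where

  _≟ₘ_ : DecidableEquality (Map n)
  _≟ₘ_ = ≡-dec _≟_

  app-∘ₚ : (σ τ : Map n) (i : Fin n) → app (σ ∘ₚ τ) i ≡ app σ (app τ i)
  app-∘ₚ σ τ i = lookup∘tabulate _ i

  app-idP : (i : Fin n) → app idP i ≡ i
  app-idP i = lookup∘tabulate _ i

  Map-ext : {σ τ : Map n} → (∀ i → app σ i ≡ app τ i) → σ ≡ τ
  Map-ext {σ} {τ} σ≗τ = trans (sym (tabulate∘lookup σ)) (trans (tabulate-cong σ≗τ) (tabulate∘lookup τ))

  ∘ₚ-assoc : (σ τ ρ : Map n) → σ ∘ₚ (τ ∘ₚ ρ) ≡ (σ ∘ₚ τ) ∘ₚ ρ
  ∘ₚ-assoc σ τ ρ = Map-ext λ i → begin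
    app (σ ∘ₚ (τ ∘ₚ ρ)) i    ≡⟨ app-∘ₚ σ (τ ∘ₚ ρ) i ⟩
    app σ (app (τ ∘ₚ ρ) i)   ≡⟨ cong (app σ) (app-∘ₚ τ ρ i) ⟩
    app σ (app τ (app ρ i))  ≡⟨ sym (app-∘ₚ σ τ (app ρ i)) ⟩
    app (σ ∘ₚ τ) (app ρ i)   ≡⟨ sym (app-∘ₚ (σ ∘ₚ τ) ρ i) ⟩
    app ((σ ∘ₚ τ) ∘ₚ ρ) i    ∎
    where open ≡-Reasoning

  ∘ₚ-identityʳ : (σ : Map n) → σ ∘ₚ idP ≡ σ
  ∘ₚ-identityʳ σ = Map-ext λ i → trans (app-∘ₚ σ idP i) (cong (app σ) (app-idP i))

  ∘ₚ-cancelˡ : (σ : Map n) {τ ρ : Map n} → IsPerm σ → σ ∘ₚ τ ≡ σ ∘ₚ ρ → τ ≡ ρ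
  ∘ₚ-cancelˡ σ {τ} {ρ} σ-inj στ≡σρ = Map-ext λ i →
    σ-inj (trans (sym (app-∘ₚ σ τ i)) (trans (cong (λ π → app π i) στ≡σρ) (app-∘ₚ σ ρ i)))

  IsInverse-sym : (σ τ : Map n) → IsPerm σ → IsInverse σ τ → IsInverse τ σ
  IsInverse-sym σ τ σ-inj στ≡id = Map-ext λ i → trans (app-∘ₚ τ σ i) (trans (σ-inj (begin
    app σ (app τ (app σ i))  ≡⟨ sym (app-∘ₚ σ τ (app σ i)) ⟩
    app (σ ∘ₚ τ) (app σ i)   ≡⟨ cong (λ π → app π (app σ i)) στ≡id ⟩
    app idP (app σ i)        ≡⟨ app-idP (app σ i) ⟩
    app σ i                  ∎)) (sym (app-idP i)))
    where open ≡-Reasoning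

  ∘ₚ-inverse-cancel : (σ τ′ τ : Map n) → IsInverse τ′ τ → (σ ∘ₚ τ′) ∘ₚ τ ≡ σ
  ∘ₚ-inverse-cancel σ τ′ τ τ′τ≡id = begin
    (σ ∘ₚ τ′) ∘ₚ τ  ≡⟨ sym (∘ₚ-assoc σ τ′ τ) ⟩
    σ ∘ₚ (τ′ ∘ₚ τ)  ≡⟨ cong (σ ∘ₚ_) τ′τ≡id ⟩
    σ ∘ₚ idP        ≡⟨ ∘ₚ-identityʳ σ ⟩
    σ               ∎
    where open ≡-Reasoning

  ∘ₚ-cancelʳ : (τ′ τ : Map n) → IsInverse τ′ τ → {σ ρ : Map n} → σ ∘ₚ τ′ ≡ ρ ∘ₚ τ′ → σ ≡ ρ
  ∘ₚ-cancelʳ τ′ τ τ′τ≡id {σ} {ρ} στ′≡ρτ′ =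
    trans (sym (∘ₚ-inverse-cancel σ τ′ τ τ′τ≡id))
          (trans (cong (_∘ₚ τ) στ′≡ρτ′) (∘ₚ-inverse-cancel ρ τ′ τ τ′τ≡id))

  open DecMembership _≟ₘ_ using (_∈?_)

  independent-take : {K I : List (Map n)} {S : Map n → Set} (k : ℕ) →
                     IsIndependent K S I → IsIndependent K S (take k I)
  independent-take {I = I} k (unique , I⊆K , nonadjacent) =
    Unique.take⁺ k unique , All.tabulate (All.lookup I⊆K ∘ take⊆I) ,
    λ g∈ h∈ → nonadjacent (take⊆I g∈) (take⊆I h∈)
    where
    take⊆I : take k I ⊆ I
    take⊆I = sublist-lookup (take-⊆ k I)

  stabilizer : List (Map n) → Fin n → List (Map n)
  stabilizer K i = filter (λ g → app g i ≟ i) K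

  ∈-stabilizer⁻ : (K : List (Map n)) {i : Fin n} {g : Map n} →
                  g ∈ stabilizer K i → g ∈ K × app g i ≡ i
  ∈-stabilizer⁻ K {i} = ∈-filter⁻ (λ g → app g i ≟ i)

  stabilizer-independent : {K : List (Map n)} {S : Map n → Set} → IsPermGroup K →
                           (∀ s → S s → IsDerangement s) → (i : Fin n) →
                           IsIndependent K S (stabilizer K i)
  stabilizer-independent {K} pK S⊆Der i =
    Unique.filter⁺ _ (IsPermGroup.unique pK) ,
    All.tabulate (proj₁ ∘ ∈-stabilizer⁻ K) ,
    nonadjacent
    where
    nonadjacent : ∀ {g h} → g ∈ stabilizer K i → h ∈ stabilizer K i → ¬ CayAdj _ g h
    nonadjacent {g} {h} g∈ h∈ (s , Ss , h≡gs) with ∈-stabilizer⁻ K g∈ | ∈-stabilizer⁻ K h∈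
    ... | g∈K , gi≡i | _ , hi≡i = S⊆Der s Ss i (All.lookup (IsPermGroup.perms pK) g∈K (begin
      app g (app s i)  ≡⟨ sym (app-∘ₚ g s i) ⟩
      app (g ∘ₚ s) i   ≡⟨ cong (λ π → app π i) (sym h≡gs) ⟩
      app h i          ≡⟨ trans hi≡i (sym gi≡i) ⟩
      app g i          ∎))
      where open ≡-Reasoning

  length≤n*length-stabilizer : {K : List (Map n)} → IsPermGroup K → IsTransitive K → (i : Fin n) →
                               length K ≤ n * length (stabilizer K i)
  length≤n*length-stabilizer {K} pK transitive i = begin
    length K
      ≤⟨ length≤∑-fibres _≟_ (λ g → app g i) K (allFin n) (λ g → ∈-allFin (app g i)) ⟩
    ∑[ j ∈ allFin n ] length (fibre j)
      ≤⟨ ∑-mono-≤ (allFin n) (λ {j} _ → fibre≤stabilizer j) ⟩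
    ∑[ j ∈ allFin n ] length (stabilizer K i)
      ≡⟨ ∑-const (allFin n) _ ⟩
    length (allFin n) * length (stabilizer K i)
      ≡⟨ cong (_* length (stabilizer K i)) (length-tabulate {n = n} (λ j → j)) ⟩
    n * length (stabilizer K i) ∎
    where
    open ≤-Reasoning
    open IsPermGroup pK
    fibre : Fin n → List (Map n)
    fibre j = filter (λ g → app g i ≟ j) K
    fibre≤stabilizer : ∀ j → length (fibre j) ≤ length (stabilizer K i)
    fibre≤stabilizer j with transitive j i
    ... | u , u∈K , uj≡i = injection⇒length-≤ (u ∘ₚ_) (∘ₚ-cancelˡ u (All.lookup perms u∈K))
          (Unique.filter⁺ _ unique) u∘g∈stabilizer
      where
      u∘g∈stabilizer : ∀ {g} → g ∈ fibre j → u ∘ₚ g ∈ stabilizer K i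
      u∘g∈stabilizer {g} g∈ with ∈-filter⁻ (λ g → app g i ≟ j) g∈
      ... | g∈K , refl = ∈-filter⁺ _ (closed u∈K g∈K) (trans (app-∘ₚ u g i) uj≡i)

  independent-of-length-order/degree : {K : List (Map n)} {S : Map n → Set} .{{_ : NonZero n}} →
    IsPermGroup K → IsTransitive K → (∀ s → S s → IsDerangement s) → Fin n →
    Σ (List (Map n)) λ I → IsIndependent K S I × length I ≡ length K / n
  independent-of-length-order/degree {K} pK transitive S⊆Der i =
    take (length K / n) (stabilizer K i) ,
    independent-take _ (stabilizer-independent pK S⊆Der i) ,
    trans (length-take _ (stabilizer K i))
          (m≤n⇒m⊓n≡m (m≤n*o⇒m/n≤o n (length≤n*length-stabilizer pK transitive i)))

  independent-subgroup-bound : {G H : List (Map n)} {S T : Map n → Set} {m : ℕ} →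
    IsPermGroup G → IsPermGroup H → H ⊆G G → (∀ s → T s → S s) →
    (∀ J → IsIndependent H T J → length J ≤ m) →
    ∀ I → IsIndependent G S I → length H * length I ≤ length G * m
  independent-subgroup-bound {G} {H} {S} {T} {m} pG pH H⊆G T⊆S α[H,T]≤m I (uniqueI , I⊆G , nonadjacentI) =
    begin
    length H * length I                ≡⟨ sym (∑-const H (length I)) ⟩
    ∑[ k ∈ H ] length I                ≤⟨ ∑-mono-≤ H length-I≤length-column ⟩
    ∑[ k ∈ H ] length (column k)       ≡⟨ double-counting (λ x k → x ∘ₚ k ∈? I) G H ⟩
    ∑[ x ∈ G ] length (row x)          ≤⟨ ∑-mono-≤ G (λ x∈G → α[H,T]≤m _ (row-independent x∈G)) ⟩
    ∑[ x ∈ G ] m                       ≡⟨ ∑-const G m ⟩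
    length G * m                       ∎
    where
    open ≤-Reasoning
    module PG = IsPermGroup pG
    module PH = IsPermGroup pH
    column : Map n → List (Map n)
    column k = filter (λ x → x ∘ₚ k ∈? I) G
    row : Map n → List (Map n)
    row x = filter (λ k → x ∘ₚ k ∈? I) H

    length-I≤length-column : ∀ {k} → k ∈ H → length I ≤ length (column k)
    length-I≤length-column {k} k∈H with PH.inverse k∈H
    ... | k′ , k′∈H , kk′≡id = injection⇒length-≤ (_∘ₚ k′) (∘ₚ-cancelʳ k′ k k′k≡id) uniqueI g∘k′∈column
      where
      k′k≡id : IsInverse k′ k
      k′k≡id = IsInverse-sym k k′ (All.lookup PH.perms k∈H) kk′≡id
      g∘k′∈column : ∀ {g} → g ∈ I → g ∘ₚ k′ ∈ column k
      g∘k′∈column {g} g∈I = ∈-filter⁺ _ (PG.closed (All.lookup I⊆G g∈I) (All.lookup H⊆G k′∈H))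
                              (subst (_∈ I) (sym (∘ₚ-inverse-cancel g k′ k k′k≡id)) g∈I)

    row-independent : ∀ {x} → x ∈ G → IsIndependent H T (row x)
    row-independent {x} x∈G = Unique.filter⁺ _ PH.unique , All.tabulate (proj₁ ∘ ∈-row⁻) ,
      λ {k₁} k₁∈ k₂∈ (s , Ts , k₂≡k₁s) → nonadjacentI (proj₂ (∈-row⁻ k₁∈)) (proj₂ (∈-row⁻ k₂∈))
        (s , T⊆S s Ts , trans (cong (x ∘ₚ_) k₂≡k₁s) (∘ₚ-assoc x k₁ s))
      where
      ∈-row⁻ : ∀ {k} → k ∈ row x → k ∈ H × x ∘ₚ k ∈ I
      ∈-row⁻ = ∈-filter⁻ (λ k → x ∘ₚ k ∈? I)

lemma6p4 : (n : ℕ) .{{_ : NonZero n}} (G H : List (Map n)) →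
    IsPermGroup G → IsPermGroup H → H ⊆G G →
    IsTransitive G → IsTransitive H → HasEKR n H →
    (D : Map n → Set) →
    (∀ g → D g → Der G g) →
    (∀ g h → D g → IsInverse g h → D h) →
    (∀ g → D g → g ∉ H) →
    IndependenceNumberIs G (λ g → Der G g × ¬ D g) (length G / n)
lemma6p4 zero {{n≢0}} _ _ _ _ _ _ _ _ _ _ _ _ = ⊥-elim-irr (NonZero.nonZero n≢0)
lemma6p4 n@(suc _) G H pG pH H⊆G transitiveG _ ekrH D _ _ D∉H =
  independent-of-length-order/degree pG transitiveG (λ s → proj₂ ∘ proj₁) Fin.zero , upper-bound
  where
  DerH⊆S : ∀ s → Der H s → Der G s × ¬ D s
  DerH⊆S s (s∈H , s-der) = (All.lookup H⊆G s∈H , s-der) , λ Ds → D∉H s Ds s∈H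
  upper-bound : ∀ I → IsIndependent G (λ g → Der G g × ¬ D g) I → length I ≤ length G / n
  upper-bound I indepI = m*n≤o*[m/p]⇒n≤o/p (length H) (length G) n
    ⦃ >-nonZero (∈-length (IsPermGroup.has-id pH)) ⦄
    (independent-subgroup-bound pG pH H⊆G DerH⊆S (proj₂ ekrH) I indepI)
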